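{- Let $k\ge1$ and $n\ge0$. Two binary trees $t,t'\in\mathcal T_n$ are $k$-equivalent if and only if $\delta_i(t)\equiv\delta_i(t')\pmod k$ for all $i\in\{0,1,\dots,n\}$.
   Context: A binary tree is a rooted plane tree in which every node has $0$ or $2$ ordered children; $\mathcal T_n$ is the set of binary trees with $n+1$ leaves, labelled $0,\dots,n$ from left to right. The left depth $\delta_i(t)$ is the number of steps to a left child on the path from the root to leaf $i$. For binary trees $s,t$, $s\wedge t$ has left subtree $s$ and right subtree $t$ at the root; iterated $\wedge$ is read left to right. A right $k$-rotation replaces a maximal subtree $(t_0\wedge t_1\wedge\cdots\wedge t_k)\wedge t_{k+1}$ by $t_0\wedge(t_1\wedge\cdots\wedge t_{k+1})$, and a left $k$-rotation is its inverse; two binary trees are $k$-equivalent if related by a finite sequence of such rotations. -}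

module Defs where

open import Data.Nat using (ℕ; zero; suc; _+_; _∸_; _<ᵇ_)
open import Data.Bool using (if_then_else_)
open import Data.List using (List; []; _∷_; _++_; [_]; length)
open import Relation.Binary.PropositionalEquality using (_≡_)

infixr 5 _∧_

data Tree : Set where
  leaf : Tree
  _∧_  : Tree → Tree → Tree

-- number of leaves; 𝒯ₙ = trees with leaves t ≡ suc n
leaves : Tree → ℕ
leaves leaf    = 1
leaves (s ∧ t) = leaves s + leaves t

-- left depth δ i t of leaf i (leaves numbered 0,1,… left to right);
-- only meaningful for i < leaves t.
δ : ℕ → Tree → ℕ
δ i leaf    = 0
δ i (s ∧ t) = if i <ᵇ leaves s then suc (δ i s) else δ (i ∸ leaves s) t

-- iterated ∧ read left to right:  comb t₀ [t₁,…,tₘ] = (…(t₀ ∧ t₁) ∧ …) ∧ tₘ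
comb : Tree → List Tree → Tree
comb t []       = t
comb t (u ∷ us) = comb (t ∧ u) us

comb′ : List Tree → Tree → Tree
comb′ []       t = t
comb′ (u ∷ us) t = comb u (us ++ [ t ])

-- right k-rotation at the root:
--   (t₀ ∧ t₁ ∧ ⋯ ∧ tₖ) ∧ tₖ₊₁  ↦  t₀ ∧ (t₁ ∧ ⋯ ∧ tₖ₊₁)
data RootRot (k : ℕ) : Tree → Tree → Set where
  rot : (t₀ : Tree) (us : List Tree) (t : Tree) → length us ≡ k →
        RootRot k (comb t₀ us ∧ t) (t₀ ∧ comb′ us t)

data RightRot (k : ℕ) : Tree → Tree → Set where
  here  : ∀ {s s′} → RootRot k s s′ → RightRot k s s′
  left  : ∀ {s s′} t → RightRot k s s′ → RightRot k (s ∧ t) (s′ ∧ t)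
  right : ∀ {s s′} t → RightRot k s s′ → RightRot k (t ∧ s) (t ∧ s′)

data _≈[_]_ : Tree → ℕ → Tree → Set where
  refl≈  : ∀ {t} {k} → t ≈[ k ] t
  rightR : ∀ {s t u} {k} → RightRot k s t → t ≈[ k ] u → s ≈[ k ] u
  leftR  : ∀ {s t u} {k} → RightRot k t s → t ≈[ k ] u → s ≈[ k ] u

-- A right k-rotation raises the left depth of every leaf of t₀ by exactly k and leaves all
-- other left depths unchanged, so the residues δᵢ mod k are invariants.  Conversely, left
-- rotations strictly increase Σᵢ δᵢ, which is bounded by (n+1)², so every tree is
-- k-equivalent to a tree in which every right subtree has left spine shorter than k.  In such
-- a tree consecutive leaves satisfy δᵢ ≤ δᵢ₊₁ + 1 < δᵢ + k and the last leaf has δₙ = 0;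
-- hence, reading the residues from right to left, each δᵢ is the unique number in a window of
-- length k with the prescribed residue.  So the residues determine all the δᵢ, and the δᵢ
-- determine the tree.
module Submission where

open import Defs
open import Data.Nat
open import Data.Nat.Properties
open import Data.Nat.DivMod
open import Data.Nat.Induction using (<-wellFounded)
open import Data.Nat.Tactic.RingSolver using (solve-∀)
open import Data.Bool using (true; false)
open import Data.Empty using (⊥-elim)
open import Data.Product using (Σ-syntax; ∃; _×_; _,_)
open import Data.Sum as Sum using (_⊎_; inj₁; inj₂)
open import Data.List using (List; []; _∷_; _++_; [_]; length)
open import Data.List.Properties using (length-++)
open import Induction.WellFounded using (Acc; acc)
open import Relation.Nullary using (yes; no)
open import Relation.Binary.PropositionalEquality hiding ([_])
open import Function.Base using (_∘′_)
open import Function.Bundles using (_⇔_; mk⇔)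

leaves>0 : ∀ t → leaves t > 0
leaves>0 leaf    = s≤s z≤n
leaves>0 (s ∧ u) = ≤-trans (leaves>0 s) (m≤m+n (leaves s) (leaves u))

leaves>1 : ∀ s u → leaves (s ∧ u) > 1
leaves>1 s u = +-mono-≤ (leaves>0 s) (leaves>0 u)

data Position (a : ℕ) : ℕ → Set where
  inside : ∀ {i} → i < a → Position a i
  beyond : ∀ j → Position a (a + j)

position : ∀ a i → Position a i
position a i with i <? a
... | yes i<a = inside i<a
... | no i≮a with j , refl ← m≤n⇒∃[o]m+o≡n (≮⇒≥ i≮a) = beyond j

δ-∧-inside : ∀ {i} s u → i < leaves s → δ i (s ∧ u) ≡ suc (δ i s)
δ-∧-inside {i} s u i<s with i <ᵇ leaves s | <⇒<ᵇ i<s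
... | true  | _ = refl
... | false | ()

δ-∧-beyond : ∀ s u j → δ (leaves s + j) (s ∧ u) ≡ δ j u
δ-∧-beyond s u j with leaves s + j <ᵇ leaves s | <ᵇ⇒< (leaves s + j) (leaves s)
... | true  | lt = ⊥-elim (m+n≮m (leaves s) j (lt _))
... | false | _  = cong (λ i → δ i u) (m+n∸m≡n (leaves s) j)

δ-last : ∀ t {i} → suc i ≡ leaves t → δ i t ≡ 0
δ-last leaf    refl = refl
δ-last (s ∧ u) {i} last with position (leaves s) i
... | inside i<s = ⊥-elim (<-irrefl refl
        (≤-trans (m<m+n (leaves s) (leaves>0 u)) (≤-trans (≤-reflexive (sym last)) i<s)))
... | beyond j   = trans (δ-∧-beyond s u j)
        (δ-last u (+-cancelˡ-≡ (leaves s) _ _ (trans (+-suc (leaves s) j) last)))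

δ-nonlast>0 : ∀ t {i} → suc i < leaves t → δ i t > 0
δ-nonlast>0 leaf    (s≤s ())
δ-nonlast>0 (s ∧ u) {i} si<t with position (leaves s) i
... | inside i<s = subst (_> 0) (sym (δ-∧-inside s u i<s)) (s≤s z≤n)
... | beyond j   = subst (_> 0) (sym (δ-∧-beyond s u j))
        (δ-nonlast>0 u (+-cancelˡ-< (leaves s) (suc j) (leaves u)
          (≤-<-trans (≤-reflexive (+-suc (leaves s) j)) si<t)))

spine : Tree → ℕ
spine leaf    = 0
spine (s ∧ u) = suc (spine s)

δ-first : ∀ t → δ 0 t ≡ spine t
δ-first leaf    = refl
δ-first (s ∧ u) = trans (δ-∧-inside s u (leaves>0 s)) (cong suc (δ-first s))

δ-∧-first : ∀ s u → δ (leaves s) (s ∧ u) ≡ spine u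
δ-∧-first s u = begin
  δ (leaves s) (s ∧ u)     ≡⟨ cong (λ i → δ i (s ∧ u)) (+-identityʳ (leaves s)) ⟨
  δ (leaves s + 0) (s ∧ u) ≡⟨ δ-∧-beyond s u 0 ⟩
  δ 0 u                    ≡⟨ δ-first u ⟩
  spine u                  ∎
  where open ≡-Reasoning

-- Otherwise the last leaf of s′ would have left depth 1 on the right but at least 2 on the left.
δ-agree⇒left-leaves-≤ : ∀ s u s′ u′ →
  (∀ i → i < leaves s → δ i (s ∧ u) ≡ δ i (s′ ∧ u′)) → leaves s ≤ leaves s′
δ-agree⇒left-leaves-≤ s u s′ u′ agree with leaves s ≤? leaves s′
... | yes s≤s′ = s≤s′
... | no s≰s′ with i , last ← m≤n⇒∃[o]m+o≡n (leaves>0 s′) =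
  ⊥-elim (<⇒≢ 0<δ δ≡0)
  where
  open ≡-Reasoning
  s′<s = ≰⇒> s≰s′
  i<s′ = ≤-reflexive last
  si<s = subst (_< leaves s) (sym last) s′<s
  0<δ : 0 < δ i s
  0<δ = δ-nonlast>0 s si<s
  δ≡0 : 0 ≡ δ i s
  δ≡0 = sym (suc-injective (begin
    suc (δ i s)      ≡⟨ δ-∧-inside s u (≤-trans (n≤1+n _) si<s) ⟨
    δ i (s ∧ u)      ≡⟨ agree i (≤-trans (n≤1+n _) si<s) ⟩
    δ i (s′ ∧ u′)    ≡⟨ δ-∧-inside s′ u′ i<s′ ⟩
    suc (δ i s′)     ≡⟨ cong suc (δ-last s′ last) ⟩
    1                ∎))

δ-injective : ∀ t t′ → leaves t ≡ leaves t′ → (∀ i → i < leaves t → δ i t ≡ δ i t′) → t ≡ t′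
δ-injective leaf    leaf      _ _ = refl
δ-injective leaf    (s ∧ u)   e _ = ⊥-elim (<⇒≢ (leaves>1 s u) e)
δ-injective (s ∧ u) leaf      e _ = ⊥-elim (<⇒≢ (leaves>1 s u) (sym e))
δ-injective (s ∧ u) (s′ ∧ u′) e agree =
  cong₂ _∧_ (δ-injective s s′ |s|≡ agree-s) (δ-injective u u′ |u|≡ agree-u)
  where
  open ≡-Reasoning
  in-s : ∀ {i} → i < leaves s → i < leaves (s ∧ u)
  in-s i<s = ≤-trans i<s (m≤m+n _ _)
  |s|≡ : leaves s ≡ leaves s′
  |s|≡ = ≤-antisym (δ-agree⇒left-leaves-≤ s u s′ u′ (λ i i<s → agree i (in-s i<s)))
    (δ-agree⇒left-leaves-≤ s′ u′ s u λ i i<s′ →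
      sym (agree i (subst (i <_) (sym e) (≤-trans i<s′ (m≤m+n _ _)))))
  |u|≡ : leaves u ≡ leaves u′
  |u|≡ = +-cancelˡ-≡ (leaves s) _ _ (trans e (cong (_+ leaves u′) (sym |s|≡)))
  agree-s : ∀ i → i < leaves s → δ i s ≡ δ i s′
  agree-s i i<s = suc-injective (begin
    suc (δ i s)   ≡⟨ δ-∧-inside s u i<s ⟨
    δ i (s ∧ u)   ≡⟨ agree i (in-s i<s) ⟩
    δ i (s′ ∧ u′) ≡⟨ δ-∧-inside s′ u′ (subst (i <_) |s|≡ i<s) ⟩
    suc (δ i s′)  ∎)
  agree-u : ∀ j → j < leaves u → δ j u ≡ δ j u′
  agree-u j j<u = begin
    δ j u                        ≡⟨ δ-∧-beyond s u j ⟨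
    δ (leaves s + j) (s ∧ u)     ≡⟨ agree (leaves s + j) (+-monoʳ-< (leaves s) j<u) ⟩
    δ (leaves s + j) (s′ ∧ u′)   ≡⟨ cong (λ a → δ (a + j) (s′ ∧ u′)) |s|≡ ⟩
    δ (leaves s′ + j) (s′ ∧ u′)  ≡⟨ δ-∧-beyond s′ u′ j ⟩
    δ j u′                       ∎

comb-snoc : ∀ t₀ us t → comb t₀ (us ++ [ t ]) ≡ comb t₀ us ∧ t
comb-snoc t₀ []       t = refl
comb-snoc t₀ (u ∷ us) t = comb-snoc (t₀ ∧ u) us t

leaves-≤-comb : ∀ t₀ us → leaves t₀ ≤ leaves (comb t₀ us)
leaves-≤-comb t₀ []       = ≤-refl
leaves-≤-comb t₀ (u ∷ us) =
  ≤-trans (m≤m+n (leaves t₀) (leaves u)) (leaves-≤-comb (t₀ ∧ u) us)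

comb-δ-inside : ∀ {i} t₀ us → i < leaves t₀ → δ i (comb t₀ us) ≡ δ i t₀ + length us
comb-δ-inside {i} t₀ []       _    = sym (+-identityʳ (δ i t₀))
comb-δ-inside {i} t₀ (u ∷ us) i<t₀ = begin
  δ i (comb (t₀ ∧ u) us)     ≡⟨ comb-δ-inside (t₀ ∧ u) us (≤-trans i<t₀ (m≤m+n _ _)) ⟩
  δ i (t₀ ∧ u) + length us   ≡⟨ cong (_+ length us) (δ-∧-inside t₀ u i<t₀) ⟩
  suc (δ i t₀ + length us)   ≡⟨ +-suc (δ i t₀) (length us) ⟨
  δ i t₀ + suc (length us)   ∎
  where open ≡-Reasoning

comb-∧-δ-inside : ∀ {i} t₀ us t → i < leaves t₀ → δ i (comb t₀ us ∧ t) ≡ suc (δ i t₀ + length us)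
comb-∧-δ-inside t₀ us t i<t₀ =
  trans (δ-∧-inside (comb t₀ us) t (≤-trans i<t₀ (leaves-≤-comb t₀ us)))
        (cong suc (comb-δ-inside t₀ us i<t₀))

comb-∧-δ-beyond : ∀ t₀ us t j → δ (leaves t₀ + j) (comb t₀ us ∧ t) ≡ δ j (comb′ us t)
comb-∧-δ-beyond t₀ []       t j = δ-∧-beyond t₀ t j
comb-∧-δ-beyond t₀ (u ∷ us) t j with position (leaves u) j
... | inside j<u = begin
  δ (leaves t₀ + j) (comb (t₀ ∧ u) us ∧ t)
    ≡⟨ comb-∧-δ-inside (t₀ ∧ u) us t (+-monoʳ-< (leaves t₀) j<u) ⟩
  suc (δ (leaves t₀ + j) (t₀ ∧ u) + length us)
    ≡⟨ cong (λ d → suc (d + length us)) (δ-∧-beyond t₀ u j) ⟩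
  suc (δ j u + length us)
    ≡⟨ comb-∧-δ-inside u us t j<u ⟨
  δ j (comb u us ∧ t)
    ≡⟨ cong (δ j) (comb-snoc u us t) ⟨
  δ j (comb u (us ++ [ t ]))
    ∎
  where open ≡-Reasoning
... | beyond j′ = begin
  δ (leaves t₀ + (leaves u + j′)) (comb (t₀ ∧ u) us ∧ t)
    ≡⟨ cong (λ i → δ i (comb (t₀ ∧ u) us ∧ t)) (+-assoc (leaves t₀) (leaves u) j′) ⟨
  δ (leaves (t₀ ∧ u) + j′) (comb (t₀ ∧ u) us ∧ t)
    ≡⟨ comb-∧-δ-beyond (t₀ ∧ u) us t j′ ⟩
  δ j′ (comb′ us t)
    ≡⟨ comb-∧-δ-beyond u us t j′ ⟨
  δ (leaves u + j′) (comb u us ∧ t)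
    ≡⟨ cong (δ (leaves u + j′)) (comb-snoc u us t) ⟨
  δ (leaves u + j′) (comb u (us ++ [ t ]))
    ∎
  where open ≡-Reasoning

rootRot-leaves : ∀ t₀ us t → leaves (comb t₀ us ∧ t) ≡ leaves (t₀ ∧ comb′ us t)
rootRot-leaves t₀ []       t = refl
rootRot-leaves t₀ (u ∷ us) t = begin
  leaves (comb (t₀ ∧ u) us ∧ t)                 ≡⟨ rootRot-leaves (t₀ ∧ u) us t ⟩
  leaves t₀ + leaves u + leaves (comb′ us t)    ≡⟨ +-assoc (leaves t₀) (leaves u) _ ⟩
  leaves t₀ + (leaves u + leaves (comb′ us t))  ≡⟨ cong (leaves t₀ +_) (rootRot-leaves u us t) ⟨
  leaves t₀ + leaves (comb u us ∧ t)            ≡⟨ cong (λ v → leaves t₀ + leaves v) (comb-snoc u us t) ⟨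
  leaves t₀ + leaves (comb u (us ++ [ t ]))     ∎
  where open ≡-Reasoning

rightRot-leaves : ∀ {k s s′} → RightRot k s s′ → leaves s ≡ leaves s′
rightRot-leaves (here (rot t₀ us t _)) = rootRot-leaves t₀ us t
rightRot-leaves (left t r)             = cong (_+ leaves t) (rightRot-leaves r)
rightRot-leaves (right t r)            = cong (leaves t +_) (rightRot-leaves r)

rootRot-δ : ∀ {k s s′} → RootRot k s s′ → ∀ i → δ i s ≡ δ i s′ + k ⊎ δ i s ≡ δ i s′
rootRot-δ (rot t₀ us t refl) i with position (leaves t₀) i
... | inside i<t₀ = inj₁ (trans (comb-∧-δ-inside t₀ us t i<t₀)
                                (cong (_+ length us) (sym (δ-∧-inside t₀ (comb′ us t) i<t₀))))
... | beyond j    = inj₂ (trans (comb-∧-δ-beyond t₀ us t j) (sym (δ-∧-beyond t₀ (comb′ us t) j)))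

rightRot-δ : ∀ {k s s′} → RightRot k s s′ → ∀ i → δ i s ≡ δ i s′ + k ⊎ δ i s ≡ δ i s′
rightRot-δ (here r) i = rootRot-δ r i
rightRot-δ (left {s} {s′} t r) i with position (leaves s) i
... | inside i<s
  rewrite δ-∧-inside s t i<s | δ-∧-inside s′ t (subst (_ <_) (rightRot-leaves r) i<s)
  = Sum.map (cong suc) (cong suc) (rightRot-δ r i)
... | beyond j = inj₂ (begin
  δ (leaves s + j) (s ∧ t)   ≡⟨ δ-∧-beyond s t j ⟩
  δ j t                      ≡⟨ δ-∧-beyond s′ t j ⟨
  δ (leaves s′ + j) (s′ ∧ t) ≡⟨ cong (λ a → δ (a + j) (s′ ∧ t)) (rightRot-leaves r) ⟨
  δ (leaves s + j) (s′ ∧ t)  ∎)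
  where open ≡-Reasoning
rightRot-δ (right {s} {s′} t r) i with position (leaves t) i
... | inside i<t = inj₂ (trans (δ-∧-inside t s i<t) (sym (δ-∧-inside t s′ i<t)))
... | beyond j rewrite δ-∧-beyond t s j | δ-∧-beyond t s′ j = rightRot-δ r j

≈-leaves : ∀ {k s s′} → s ≈[ k ] s′ → leaves s ≡ leaves s′
≈-leaves refl≈        = refl
≈-leaves (rightR r e) = trans (rightRot-leaves r) (≈-leaves e)
≈-leaves (leftR r e)  = trans (sym (rightRot-leaves r)) (≈-leaves e)

≈-trans : ∀ {k a b c} → a ≈[ k ] b → b ≈[ k ] c → a ≈[ k ] c
≈-trans refl≈        e′ = e′
≈-trans (rightR r e) e′ = rightR r (≈-trans e e′)
≈-trans (leftR r e)  e′ = leftR r (≈-trans e e′)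

≈-sym : ∀ {k a b} → a ≈[ k ] b → b ≈[ k ] a
≈-sym refl≈        = refl≈
≈-sym (rightR r e) = ≈-trans (≈-sym e) (leftR r refl≈)
≈-sym (leftR r e)  = ≈-trans (≈-sym e) (rightR r refl≈)

-- leftDepthSum t = Σᵢ δ i t, since every leaf of s gains one left step in s ∧ u.
leftDepthSum : Tree → ℕ
leftDepthSum leaf    = 0
leftDepthSum (s ∧ u) = leftDepthSum s + leaves s + leftDepthSum u

leftDepthSum-≤ : ∀ t → leftDepthSum t ≤ leaves t * leaves t
leftDepthSum-≤ leaf    = z≤n
leftDepthSum-≤ (s ∧ u) = begin
  leftDepthSum s + a + leftDepthSum u
    ≤⟨ +-mono-≤ (+-monoˡ-≤ a (leftDepthSum-≤ s)) (leftDepthSum-≤ u) ⟩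
  a * a + a + b * b
    ≤⟨ +-monoˡ-≤ (b * b) (+-monoʳ-≤ (a * a) (m≤m*n a b {{>-nonZero (leaves>0 u)}})) ⟩
  a * a + a * b + b * b               ≤⟨ m≤m+n _ (a * b) ⟩
  a * a + a * b + b * b + a * b       ≡⟨ square a b ⟩
  (a + b) * (a + b)                   ∎
  where
  open ≤-Reasoning
  a = leaves s
  b = leaves u
  square : ∀ a b → a * a + a * b + b * b + a * b ≡ (a + b) * (a + b)
  square = solve-∀

rootRot-leftDepthSum : ∀ t₀ us t →
  leftDepthSum (comb t₀ us ∧ t) ≡ leftDepthSum (t₀ ∧ comb′ us t) + length us * leaves t₀
rootRot-leftDepthSum t₀ []       t = sym (+-identityʳ _)
rootRot-leftDepthSum t₀ (u ∷ us) t = begin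
  leftDepthSum (comb (t₀ ∧ u) us ∧ t)
    ≡⟨ rootRot-leftDepthSum (t₀ ∧ u) us t ⟩
  (w₀ + a + wᵤ) + (a + b) + w + m * (a + b)
    ≡⟨ regroup w₀ a wᵤ b w m ⟩
  w₀ + a + ((wᵤ + b + w) + m * b) + (a + m * a)
    ≡⟨ cong (λ x → w₀ + a + x + (a + m * a)) (rootRot-leftDepthSum u us t) ⟨
  w₀ + a + leftDepthSum (comb u us ∧ t) + (a + m * a)
    ≡⟨ cong (λ v → w₀ + a + leftDepthSum v + (a + m * a)) (comb-snoc u us t) ⟨
  leftDepthSum (t₀ ∧ comb u (us ++ [ t ])) + suc m * a
    ∎
  where
  open ≡-Reasoning
  w₀ = leftDepthSum t₀
  wᵤ = leftDepthSum u
  w  = leftDepthSum (comb′ us t)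
  a  = leaves t₀
  b  = leaves u
  m  = length us
  regroup : ∀ w₀ a wᵤ b w m →
    (w₀ + a + wᵤ) + (a + b) + w + m * (a + b) ≡ w₀ + a + ((wᵤ + b + w) + m * b) + (a + m * a)
  regroup = solve-∀

comb-split : ∀ {m} s → m ≤ spine s →
  Σ[ t₀ ∈ Tree ] Σ[ us ∈ List Tree ] length us ≡ m × comb t₀ us ≡ s
comb-split {zero}  s       _      = s , [] , refl , refl
comb-split {suc m} (a ∧ b) (s≤s m≤a) with comb-split a m≤a
... | t₀ , us , refl , refl =
  t₀ , us ++ [ b ] , trans (length-++ us) (+-comm (length us) 1) , comb-snoc t₀ us b

data InWindow (k a c : ℕ) : Set where
  window : a ≤ c → c < a + k → InWindow k a c

module _ (k : ℕ) .{{_ : NonZero k}} where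

  rightRot-δ-mod : ∀ {s s′} → RightRot k s s′ → ∀ i → δ i s % k ≡ δ i s′ % k
  rightRot-δ-mod r i with rightRot-δ r i
  ... | inj₁ raised    = trans (cong (_% k) raised) ([m+n]%n≡m%n _ k)
  ... | inj₂ unchanged = cong (_% k) unchanged

  ≈⇒δ-mod : ∀ {s s′} → s ≈[ k ] s′ → ∀ i → δ i s % k ≡ δ i s′ % k
  ≈⇒δ-mod refl≈        i = refl
  ≈⇒δ-mod (rightR r e) i = trans (rightRot-δ-mod r i) (≈⇒δ-mod e i)
  ≈⇒δ-mod (leftR r e)  i = trans (sym (rightRot-δ-mod r i)) (≈⇒δ-mod e i)

  rightRot-leftDepthSum : ∀ {s s′} → RightRot k s s′ → leftDepthSum s′ < leftDepthSum s
  rightRot-leftDepthSum (here (rot t₀ us t refl)) =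
    subst (leftDepthSum (t₀ ∧ comb′ us t) <_) (sym (rootRot-leftDepthSum t₀ us t))
      (m<m+n _ (*-mono-≤ (>-nonZero⁻¹ k) (leaves>0 t₀)))
  rightRot-leftDepthSum (left {s} {s′} t r) =
    +-monoˡ-< (leftDepthSum t)
      (subst (λ a → leftDepthSum s′ + a < leftDepthSum s + leaves s) (rightRot-leaves r)
        (+-monoˡ-< (leaves s) (rightRot-leftDepthSum r)))
  rightRot-leftDepthSum (right t r) = +-monoʳ-< (leftDepthSum t + leaves t) (rightRot-leftDepthSum r)

  slack : Tree → ℕ
  slack t = leaves t * leaves t ∸ leftDepthSum t

  rightRot-slack : ∀ {s s′} → RightRot k s s′ → slack s < slack s′
  rightRot-slack {s} {s′} r rewrite rightRot-leaves r =
    ∸-monoʳ-< (rightRot-leftDepthSum r)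
      (subst (λ a → leftDepthSum s ≤ a * a) (rightRot-leaves r) (leftDepthSum-≤ s))

  data Normal : Tree → Set where
    leaf : Normal leaf
    node : ∀ {s u} → spine u < k → Normal s → Normal u → Normal (s ∧ u)

  left-rotation : ∀ s u → k ≤ spine u → ∃ λ t′ → RightRot k t′ (s ∧ u)
  left-rotation s leaf    k≤0 = ⊥-elim (<⇒≱ (>-nonZero⁻¹ k) k≤0)
  left-rotation s (a ∧ t) k≤u with comb-split a (pred-mono-≤ k≤u)
  ... | t₁ , us , |us| , refl =
    comb s (t₁ ∷ us) ∧ t ,
    here (subst (λ v → RootRot k (comb s (t₁ ∷ us) ∧ t) (s ∧ v)) (comb-snoc t₁ us t)
           (rot s (t₁ ∷ us) t (trans (cong suc |us|) (suc-pred k))))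

  normal? : ∀ t → Normal t ⊎ ∃ λ t′ → RightRot k t′ t
  normal? leaf = inj₁ leaf
  normal? (s ∧ u) with normal? s | normal? u | spine u <? k
  ... | inj₂ (s′ , r) | _             | _      = inj₂ (s′ ∧ u , left u r)
  ... | inj₁ _        | inj₂ (u′ , r) | _      = inj₂ (s ∧ u′ , right s r)
  ... | inj₁ ns       | inj₁ nu       | yes sp = inj₁ (node sp ns nu)
  ... | inj₁ _        | inj₁ _        | no sp  = inj₂ (left-rotation s u (≮⇒≥ sp))

  normalise : ∀ t → Acc _<_ (slack t) → Σ[ t* ∈ Tree ] Normal t* × t ≈[ k ] t*
  normalise t (acc rs) with normal? t
  ... | inj₁ nt       = t , nt , refl≈
  ... | inj₂ (t′ , r) with normalise t′ (rs (rightRot-slack r))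
  ...   | t* , nt* , t′≈t* = t* , nt* , leftR r t′≈t*

  normal-form : ∀ t → Σ[ t* ∈ Tree ] Normal t* × t ≈[ k ] t*
  normal-form t = normalise t (<-wellFounded (slack t))

  %-injective-window : ∀ {a b} → a ≤ b → b < a + k → a % k ≡ b % k → a ≡ b
  %-injective-window {a} {b} a≤b b<a+k a≡b with m≤n⇒m<n∨m≡n (/-monoˡ-≤ k a≤b)
  ... | inj₂ q = begin
    a                 ≡⟨ m≡m%n+[m/n]*n a k ⟩
    a % k + a / k * k ≡⟨ cong₂ (λ r q → r + q * k) a≡b q ⟩
    b % k + b / k * k ≡⟨ m≡m%n+[m/n]*n b k ⟨
    b                 ∎
    where open ≡-Reasoning
  ... | inj₁ q = ⊥-elim (<⇒≱ b<a+k (begin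
    a + k                   ≡⟨ cong (_+ k) (m≡m%n+[m/n]*n a k) ⟩
    a % k + a / k * k + k   ≡⟨ +-assoc (a % k) _ k ⟩
    a % k + (a / k * k + k) ≡⟨ cong (a % k +_) (+-comm _ k) ⟩
    a % k + suc (a / k) * k ≤⟨ +-mono-≤ (≤-reflexive a≡b) (*-monoˡ-≤ k q) ⟩
    b % k + b / k * k       ≡⟨ m≡m%n+[m/n]*n b k ⟨
    b                       ∎))
    where open ≤-Reasoning

  InWindow-unique : ∀ {a b c} → InWindow k a c → InWindow k b c → a % k ≡ b % k → a ≡ b
  InWindow-unique {a} {b} (window a≤c c<a+k) (window b≤c c<b+k) a≡b with ≤-total a b
  ... | inj₁ a≤b = %-injective-window a≤b (≤-trans (s≤s b≤c) c<a+k) a≡b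
  ... | inj₂ b≤a = sym (%-injective-window b≤a (≤-trans (s≤s a≤c) c<b+k) (sym a≡b))

  normal-δ-step : ∀ {t} → Normal t → ∀ i → suc i < leaves t →
    InWindow k (δ i t) (suc (δ (suc i) t))
  normal-δ-step leaf i (s≤s ())
  normal-δ-step (node {s} {u} sp<k ns nu) i si<t with position (leaves s) i
  ... | beyond j
    rewrite sym (+-suc (leaves s) j) | δ-∧-beyond s u j | δ-∧-beyond s u (suc j)
    = normal-δ-step nu j (+-cancelˡ-< (leaves s) (suc j) (leaves u) si<t)
  ... | inside i<s with m≤n⇒m<n∨m≡n i<s
  ...   | inj₁ si<s rewrite δ-∧-inside s u i<s | δ-∧-inside s u si<s
    with window ≤c c< ← normal-δ-step ns i si<s = window (s≤s ≤c) (s≤s c<)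
  ...   | inj₂ si≡s rewrite δ-∧-inside s u i<s | δ-last s si≡s | si≡s | δ-∧-first s u
    = window (s≤s z≤n) (s≤s sp<k)

  normal-δ-determined : ∀ {n a b} → Normal a → Normal b → leaves a ≡ suc n → leaves b ≡ suc n →
    (∀ i → i ≤ n → δ i a % k ≡ δ i b % k) → ∀ i → i ≤ n → δ i a ≡ δ i b
  normal-δ-determined {n} {a} {b} na nb |a| |b| residues i i≤n =
    let d , i+d≡n = m≤n⇒∃[o]m+o≡n i≤n in from-last d i i+d≡n
    where
    from-last : ∀ d i → i + d ≡ n → δ i a ≡ δ i b
    from-last zero i i+0≡n =
      trans (δ-last a (trans last (sym |a|))) (sym (δ-last b (trans last (sym |b|))))
      where last = cong suc (trans (sym (+-identityʳ i)) i+0≡n)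
    from-last (suc d) i i+d≡n =
      InWindow-unique (normal-δ-step na i (inside-of {a} |a|))
        (subst (InWindow k (δ i b) ∘′ suc) (sym next) (normal-δ-step nb i (inside-of {b} |b|)))
        (residues i (≤-trans (m≤m+n i (suc d)) (≤-reflexive i+d≡n)))
      where
      si+d≡n : suc i + d ≡ n
      si+d≡n = trans (sym (+-suc i d)) i+d≡n
      next : δ (suc i) a ≡ δ (suc i) b
      next = from-last d (suc i) si+d≡n
      inside-of : ∀ {t} → leaves t ≡ suc n → suc i < leaves t
      inside-of |t| =
        subst (suc i <_) (sym |t|) (s≤s (≤-trans (m≤m+n (suc i) d) (≤-reflexive si+d≡n)))

  normal-unique : ∀ {n a b} → Normal a → Normal b → leaves a ≡ suc n → leaves b ≡ suc n →
    (∀ i → i ≤ n → δ i a % k ≡ δ i b % k) → a ≡ b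
  normal-unique na nb |a| |b| residues = δ-injective _ _ (trans |a| (sym |b|)) λ i i<a →
    normal-δ-determined na nb |a| |b| residues i (s≤s⁻¹ (subst (i <_) |a| i<a))

proposition2p11 : (k n : ℕ) → .{{_ : NonZero k}} → (t t′ : Tree) →
    leaves t ≡ suc n → leaves t′ ≡ suc n →
    (t ≈[ k ] t′ ⇔ (∀ i → i ≤ n → δ i t % k ≡ δ i t′ % k))
proposition2p11 k n t t′ |t| |t′| = mk⇔ (λ t≈t′ i _ → ≈⇒δ-mod k t≈t′ i) complete
  where
  complete : (∀ i → i ≤ n → δ i t % k ≡ δ i t′ % k) → t ≈[ k ] t′
  complete residues
    with a , na , t≈a ← normal-form k t | b , nb , t′≈b ← normal-form k t′
    = ≈-trans t≈a (subst (_≈[ k ] t′) (sym a≡b) (≈-sym t′≈b))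
    where
    a≡b : a ≡ b
    a≡b = normal-unique k na nb (trans (sym (≈-leaves t≈a)) |t|) (trans (sym (≈-leaves t′≈b)) |t′|)
      λ i i≤n → trans (sym (≈⇒δ-mod k t≈a i)) (trans (residues i i≤n) (≈⇒δ-mod k t′≈b i))
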